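{- Let $G$ be a graph, let $H$ be a connected graph with at least one edge, and let $G'$ be a subdivision of $G^*$. Then $\mathrm{pack}_{H^+}(G^*)=\mathrm{pack}_{H^+}(G')$ and $\mathrm{cover}_{H^+}(G^*)=\mathrm{cover}_{H^+}(G')$.
   Context: Graphs are finite, loopless, may have multiple edges; $\mathrm{mdeg}_G(v)$ is the number of edges incident with $v$ counting multiplicities. $G$ contains $H$ as an immersion if there is $(\phi,\psi)$ with $\phi:V(H)\to V(G)$ injective and $\psi$ mapping each edge of $H$ (each copy of a multiple edge separately) with endpoints $u,v$ to a path of $G$ between $\phi(u),\phi(v)$, distinct edges going to edge-disjoint paths; the $H$-immersion expansion is the subgraph formed by $\phi(V(H))$ and the vertices and edges of these paths. $\mathrm{pack}_H(G)$ is the maximum number of pairwise edge-disjoint $H$-immersion expansions in $G$; $\mathrm{cover}_H(G)$ is the minimum size of $C\subseteq E(G)$ such that $G\setminus C$ does not contain $H$ as an immersion. $H^+$ is obtained from $H$ by adding, for every vertex $v$, new vertices $v',v''$, an edge $\{v',v''\}$ of multiplicity 2, and edges $\{v,v'\},\{v,v''\}$ of multiplicity 1. $G^*$ is obtained from $G$ by adding, for every vertex $v$ and every $i\in\{1,\dots,\mathrm{mdeg}_G(v)\}$, new vertices $v'_i,v''_i$, an edge $\{v'_i,v''_i\}$ of multiplicity 2, and edges $\{v,v'_i\},\{v,v''_i\}$ of multiplicity 1. -}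

module Defs where

open import Data.Nat using (ℕ; zero; suc; _≤_; _<?_)
open import Data.Fin using (Fin; toℕ; fromℕ<) renaming (_≟_ to _≟F_)
import Data.Fin as F
open import Data.List using (List; []; _∷_; length; map)
open import Data.Nat.ListAction using (sum)
open import Data.List.Base using (allFin)
open import Data.List.Membership.Propositional using (_∈_; _∉_)
open import Data.List.Relation.Unary.Unique.Propositional using (Unique)
open import Data.Product using (Σ; ∃; _×_; _,_; proj₁; proj₂)
open import Data.Sum using (_⊎_; inj₁; inj₂)
open import Data.Bool using (Bool; true; false; if_then_else_)
open import Data.Empty using (⊥)
open import Relation.Nullary using (¬_; yes; no; does)
open import Relation.Binary.PropositionalEquality using (_≡_; _≢_)
open import Function.Definitions using (Injective)

-- General multigraphs: an edge is an element of E, with two ends.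
-- Multiple edges = distinct elements of E with the same ends.

record Graph : Set₁ where
  field
    V    : Set
    E    : Set
    ends : E → V × V
open Graph public

record FinGraph : Set where
  field
    n    : ℕ
    m    : ℕ
    endsF : Fin m → Fin n × Fin n
open FinGraph public

toGraph : FinGraph → Graph
toGraph G = record { V = Fin (n G) ; E = Fin (m G) ; ends = endsF G }

Loopless : FinGraph → Set
Loopless G = ∀ e → proj₁ (endsF G e) ≢ proj₂ (endsF G e)

-- mdeg_G(v): number of edges incident with v (graph is loopless).
incident : (G : FinGraph) → Fin (n G) → Fin (m G) → ℕ
incident G v e =
  if does (v ≟F proj₁ (endsF G e)) then 1
  else if does (v ≟F proj₂ (endsF G e)) then 1 else 0

mdeg : (G : FinGraph) → Fin (n G) → ℕ
mdeg G v = sum (map (incident G v) (allFin (m G)))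

Joins : (G : Graph) → E G → V G → V G → Set
Joins G e u w = (ends G e ≡ (u , w)) ⊎ (ends G e ≡ (w , u))

data Walk (G : Graph) : V G → V G → Set where
  nil  : ∀ {u} → Walk G u u
  cons : ∀ {u w v} (e : E G) → Joins G e u w → Walk G w v → Walk G u v

walkVertices : ∀ {G u v} → Walk G u v → List (V G)
walkVertices {u = u} nil = u ∷ []
walkVertices {u = u} (cons e _ p) = u ∷ walkVertices p

walkEdges : ∀ {G u v} → Walk G u v → List (E G)
walkEdges nil = []
walkEdges (cons e _ p) = e ∷ walkEdges p

record Path (G : Graph) (u v : V G) : Set where
  field
    walk     : Walk G u v
    distinct : Unique (walkVertices walk)
open Path public

pathEdges : ∀ {G u v} → Path G u v → List (E G)
pathEdges p = walkEdges (walk p)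

Connected : Graph → Set
Connected G = ∀ (u v : V G) → Walk G u v

DisjointL : {A : Set} → List A → List A → Set
DisjointL xs ys = ∀ x → x ∈ xs → x ∈ ys → ⊥

record Immersion (H G : Graph) : Set where
  field
    φ     : V H → V G
    φ-inj : Injective _≡_ _≡_ φ
    ψ     : (e : E H) → Path G (φ (proj₁ (ends H e))) (φ (proj₂ (ends H e)))
    ψ-disj : ∀ e e′ → e ≢ e′ → DisjointL (pathEdges (ψ e)) (pathEdges (ψ e′))
open Immersion public

EdgeDisjointExp : ∀ {H G} → Immersion H G → Immersion H G → Set
EdgeDisjointExp I J =
  ∀ e e′ → DisjointL (pathEdges (ψ I e)) (pathEdges (ψ J e′))

Packing : Graph → Graph → ℕ → Set
Packing H G k =
  Σ (Fin k → Immersion H G) λ I →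
    ∀ i j → i ≢ j → EdgeDisjointExp (I i) (I j)

IsPack : Graph → Graph → ℕ → Set
IsPack H G k = Packing H G k × (∀ k′ → Packing H G k′ → k′ ≤ k)

_∖_ : (G : Graph) → List (E G) → Graph
G ∖ C = record { V = V G ; E = Σ (E G) (λ e → e ∉ C) ; ends = λ e → ends G (proj₁ e) }

IsCoverSet : Graph → (G : Graph) → List (E G) → Set
IsCoverSet H G C = Unique C × ¬ Immersion H (G ∖ C)

IsCover : Graph → Graph → ℕ → Set
IsCover H G c =
  (Σ (List (E G)) λ C → IsCoverSet H G C × length C ≡ c)
  × (∀ C → IsCoverSet H G C → c ≤ length C)

-- Attaching gadgets: for every vertex v and every i < f v, new vertices
-- v'_i (false) , v''_i (true), edge {v'_i,v''_i} twice (Fin 4: 2,3),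
-- edges {v,v'_i} (0) and {v,v''_i} (1).

attach : (K : Graph) → (V K → ℕ) → Graph
attach K f = record { V = V' ; E = E' ; ends = ends' }
  where
  V' = V K ⊎ (Σ (V K) (λ v → Fin (f v)) × Bool)
  E' = E K ⊎ (Σ (V K) (λ v → Fin (f v)) × Fin 4)
  ends' : E' → V' × V'
  ends' (inj₁ e) = inj₁ (proj₁ (ends K e)) , inj₁ (proj₂ (ends K e))
  ends' (inj₂ (vi , F.zero)) = inj₁ (proj₁ vi) , inj₂ (vi , false)
  ends' (inj₂ (vi , F.suc F.zero)) = inj₁ (proj₁ vi) , inj₂ (vi , true)
  ends' (inj₂ (vi , F.suc (F.suc _))) = inj₂ (vi , false) , inj₂ (vi , true)

_⁺ : Graph → Graph
H ⁺ = attach H (λ _ → 1)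

_* : FinGraph → Graph
G * = attach (toGraph G) (mdeg G)

-- Subdivision: edge e is replaced by a path with s e internal vertices.

subdivide : (K : Graph) → (E K → ℕ) → Graph
subdivide K s = record { V = V' ; E = E' ; ends = ends' }
  where
  V' = V K ⊎ Σ (E K) (λ e → Fin (s e))
  E' = Σ (E K) (λ e → Fin (suc (s e)))
  -- k-th point along e: 0 = first end, 1..s e internal, s e + 1 = second end
  point : (e : E K) → ℕ → V'
  point e zero = inj₁ (proj₁ (ends K e))
  point e (suc k) with k <? s e
  ... | yes p = inj₂ (e , fromℕ< p)
  ... | no _  = inj₁ (proj₂ (ends K e))
  ends' : E' → V' × V'
  ends' (e , j) = point e (toℕ j) , point e (suc (toℕ j))

-- Every vertex of H⁺ is an end of three distinct edges, while a subdivision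
-- vertex is an end of only two. Since the paths of an immersion are
-- edge-disjoint, a branch vertex can therefore never sit on a subdivision
-- vertex. Hence an immersion in the subdivision projects to one in G*
-- (collapse each subdivided edge back to the original edge), and an
-- immersion in G* lifts to the subdivision (replace each edge by its
-- subdivided path). Both transformations keep edge-disjointness, so packings
-- correspond; for covers, a deleted edge of G* corresponds to deleting the
-- last segment of its subdivision, and conversely.
module Submission where

open import Defs
open import Data.Nat using (ℕ; zero; suc; _≤_; _<_; _<?_)
open import Data.Nat.Properties using (≤-refl; ≤-antisym; ≤-trans; ≤-reflexive; ≮⇒≥; n≮n; <⇒≤; suc-injective)
open import Data.Fin using (Fin; toℕ; fromℕ; fromℕ<; inject₁) renaming (_≟_ to _≟F_)
import Data.Fin as Fin
open import Data.Fin.Properties using (toℕ-injective; toℕ-fromℕ; toℕ-fromℕ<; toℕ-inject₁; toℕ≤pred[n])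
open import Data.Bool using (true; false)
open import Data.Bool.Properties using () renaming (_≟_ to _≟B_)
open import Data.List using (List; []; _∷_; _++_; map; length; deduplicate)
open import Data.List.Properties using (length-map; length-deduplicate)
open import Data.List.Membership.Propositional using (_∈_; _∉_)
open import Data.List.Membership.Propositional.Properties using (∈-++⁻; ∈-map⁺; ∈-deduplicate⁺)
import Data.List.Membership.DecPropositional as DecMembership
open import Data.List.Relation.Binary.Subset.Propositional using (_⊆_)
open import Data.List.Relation.Unary.Any using (here; there)
open import Data.List.Relation.Unary.All using ([])
open import Data.List.Relation.Unary.All.Properties.Core using (¬Any⇒All¬)
open import Data.List.Relation.Unary.AllPairs.Core using ([]; _∷_)
open import Data.List.Relation.Unary.Unique.Propositional using (Unique)
import Data.List.Relation.Unary.Unique.Propositional.Properties as Unique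
import Data.List.Relation.Unary.Unique.DecPropositional.Properties as UniqueDec
open import Data.Product using (Σ; ∃; _×_; _,_; proj₁; proj₂)
import Data.Product.Properties as Product
open import Data.Sum using (_⊎_; inj₁; inj₂; [_,_]′) renaming (map to map⊎)
import Data.Sum.Properties as Sum
open import Data.Empty using (⊥; ⊥-elim)
open import Relation.Nullary using (¬_; yes; no; Dec)
open import Relation.Binary.Definitions using (DecidableEquality)
open import Relation.Binary.PropositionalEquality using (_≡_; _≢_; refl; sym; trans; cong; subst)
open import Function using (_∘_; id)
open import Function.Definitions using (Injective)
open import Function.Bundles using (_⇔_; mk⇔)

IsEndOf : (G : Graph) → E G → V G → Set
IsEndOf G e x = x ≡ proj₁ (ends G e) ⊎ x ≡ proj₂ (ends G e)

IsLoopless : Graph → Set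
IsLoopless G = ∀ e → proj₁ (ends G e) ≢ proj₂ (ends G e)

record ThreeIncidentEdges (G : Graph) (x : V G) : Set where
  field
    {e₁ e₂ e₃} : E G
    e₁≢e₂ : e₁ ≢ e₂
    e₁≢e₃ : e₁ ≢ e₃
    e₂≢e₃ : e₂ ≢ e₃
    x∈e₁ : IsEndOf G e₁ x
    x∈e₂ : IsEndOf G e₂ x
    x∈e₃ : IsEndOf G e₃ x

AtMostTwoIncidentEdges : (G : Graph) → V G → Set
AtMostTwoIncidentEdges G x =
  ∀ {g₁ g₂ g₃} → IsEndOf G g₁ x → IsEndOf G g₂ x → IsEndOf G g₃ x →
  g₁ ≡ g₂ ⊎ g₁ ≡ g₃ ⊎ g₂ ≡ g₃

pigeonhole-two : {A : Set} {a b x y z : A} →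
  x ≡ a ⊎ x ≡ b → y ≡ a ⊎ y ≡ b → z ≡ a ⊎ z ≡ b → x ≡ y ⊎ x ≡ z ⊎ y ≡ z
pigeonhole-two (inj₁ refl) (inj₁ refl) _           = inj₁ refl
pigeonhole-two (inj₂ refl) (inj₂ refl) _           = inj₁ refl
pigeonhole-two (inj₁ refl) (inj₂ refl) (inj₁ refl) = inj₂ (inj₁ refl)
pigeonhole-two (inj₁ refl) (inj₂ refl) (inj₂ refl) = inj₂ (inj₂ refl)
pigeonhole-two (inj₂ refl) (inj₁ refl) (inj₁ refl) = inj₂ (inj₂ refl)
pigeonhole-two (inj₂ refl) (inj₁ refl) (inj₂ refl) = inj₂ (inj₁ refl)

module _ {G : Graph} where

  Joins-sym : ∀ {e u w} → Joins G e u w → Joins G e w u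
  Joins-sym (inj₁ p) = inj₂ p
  Joins-sym (inj₂ p) = inj₁ p

  _++ʷ_ : ∀ {u v w} → Walk G u v → Walk G v w → Walk G u w
  nil ++ʷ q = q
  cons e j p ++ʷ q = cons e j (p ++ʷ q)

  walkEdges-++ʷ : ∀ {u v w} (p : Walk G u v) (q : Walk G v w) →
    walkEdges (p ++ʷ q) ≡ walkEdges p ++ walkEdges q
  walkEdges-++ʷ nil q = refl
  walkEdges-++ʷ (cons e j p) q = cong (e ∷_) (walkEdges-++ʷ p q)

  reverseʷ : ∀ {u v} → Walk G u v → Walk G v u
  reverseʷ nil = nil
  reverseʷ (cons e j p) = reverseʷ p ++ʷ cons e (Joins-sym j) nil

  reverseʷ-⊆ : ∀ {u v} (p : Walk G u v) → walkEdges (reverseʷ p) ⊆ walkEdges p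
  reverseʷ-⊆ nil ()
  reverseʷ-⊆ (cons e j p) x∈
    with ∈-++⁻ (walkEdges (reverseʷ p)) (subst (_ ∈_) (walkEdges-++ʷ (reverseʷ p) _) x∈)
  ... | inj₁ x∈p = there (reverseʷ-⊆ p x∈p)
  ... | inj₂ (here x≡e) = here x≡e

  castʷ : ∀ {u u′ v v′} → u ≡ u′ → v ≡ v′ → Walk G u v → Walk G u′ v′
  castʷ refl refl w = w

  castʷ-⊆ : ∀ {u u′ v v′} (p : u ≡ u′) (q : v ≡ v′) (w : Walk G u v) →
    walkEdges (castʷ p q w) ⊆ walkEdges w
  castʷ-⊆ refl refl w = id

  Joins⇒IsEndOf : ∀ {e u w} → Joins G e u w → IsEndOf G e u
  Joins⇒IsEndOf (inj₁ p) = inj₁ (cong proj₁ (sym p))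
  Joins⇒IsEndOf (inj₂ p) = inj₂ (cong proj₂ (sym p))

  firstEdge : ∀ {u v} (w : Walk G u v) →
    u ≡ v ⊎ ∃ λ g → g ∈ walkEdges w × IsEndOf G g u
  firstEdge nil = inj₁ refl
  firstEdge (cons g j _) = inj₂ (g , here refl , Joins⇒IsEndOf j)

  lastEdge : ∀ {u v} (w : Walk G u v) →
    u ≡ v ⊎ ∃ λ g → g ∈ walkEdges w × IsEndOf G g v
  lastEdge w with firstEdge (reverseʷ w)
  ... | inj₁ v≡u = inj₁ (sym v≡u)
  ... | inj₂ (g , g∈ , v∈g) = inj₂ (g , reverseʷ-⊆ w g∈ , v∈g)

  connected⇒noIsolatedVertex : Connected G → E G → ∀ v → ∃ λ e → IsEndOf G e v
  connected⇒noIsolatedVertex connected e v with firstEdge (connected v (proj₁ (ends G e)))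
  ... | inj₁ v≡end = e , inj₁ v≡end
  ... | inj₂ (g , _ , v∈g) = g , v∈g

  module _ (_≟_ : DecidableEquality (V G)) where
    open DecMembership _≟_ using (_∈?_)

    suffixFrom : ∀ {u w v} (q : Walk G w v) → u ∈ walkVertices q →
      Σ (Walk G u v) λ r →
        (Unique (walkVertices q) → Unique (walkVertices r)) × walkEdges r ⊆ walkEdges q
    suffixFrom nil (here refl) = nil , id , id
    suffixFrom q@(cons _ _ _) (here refl) = q , id , id
    suffixFrom (cons e j p) (there u∈p) with suffixFrom p u∈p
    ... | r , unique , r⊆p = r , (λ { (_ ∷ u) → unique u }) , there ∘ r⊆p

    shortcut : ∀ {u v} (w : Walk G u v) → Σ (Path G u v) λ p → pathEdges p ⊆ walkEdges w
    shortcut nil = record { walk = nil ; distinct = [] ∷ [] } , id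
    shortcut {u} (cons e j w) with shortcut w
    ... | p , p⊆w with u ∈? walkVertices (walk p)
    ... | yes u∈p =
      let r , unique , r⊆p = suffixFrom (walk p) u∈p
      in record { walk = r ; distinct = unique (distinct p) } , there ∘ p⊆w ∘ r⊆p
    ... | no u∉p =
      record { walk = cons e j (walk p) ; distinct = ¬Any⇒All¬ _ u∉p ∷ distinct p } ,
      λ { (here g≡e) → here g≡e ; (there g∈p) → there (p⊆w g∈p) }

orient : ∀ {A B : Graph} {a x y} (f : V A → V B) → Joins A a x y →
  (w : Walk B (f (proj₁ (ends A a))) (f (proj₂ (ends A a)))) →
  Σ (Walk B (f x) (f y)) λ w′ → walkEdges w′ ⊆ walkEdges w
orient f (inj₁ p) w = castʷ (cong (f ∘ proj₁) p) (cong (f ∘ proj₂) p) w , castʷ-⊆ _ _ w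
orient f (inj₂ p) w =
  castʷ (cong (f ∘ proj₂) p) (cong (f ∘ proj₁) p) (reverseʷ w) , reverseʷ-⊆ w ∘ castʷ-⊆ _ _ (reverseʷ w)

-- ⊥ is definitionally proof-irrelevant, hence so is every negation.
Σ¬-≡ : ∀ {A : Set} {P : A → Set} {a a′ : Σ A (¬_ ∘ P)} → proj₁ a ≡ proj₁ a′ → a ≡ a′
Σ¬-≡ {a = _ , _} {_ , _} refl = refl

∖-atMostTwo : ∀ {G C x} → AtMostTwoIncidentEdges G x → AtMostTwoIncidentEdges (G ∖ C) x
∖-atMostTwo atMostTwo x∈g₁ x∈g₂ x∈g₃ with atMostTwo x∈g₁ x∈g₂ x∈g₃
... | inj₁ p = inj₁ (Σ¬-≡ p)
... | inj₂ (inj₁ p) = inj₂ (inj₁ (Σ¬-≡ p))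
... | inj₂ (inj₂ p) = inj₂ (inj₂ (Σ¬-≡ p))

module _ {H B : Graph} (H-loopless : IsLoopless H) (I : Immersion H B) where
  open ThreeIncidentEdges

  imageEdgeAt : ∀ {e x} → IsEndOf H e x →
    ∃ λ g → g ∈ pathEdges (ψ I e) × IsEndOf B g (φ I x)
  imageEdgeAt {e} (inj₁ refl) = [ ⊥-elim ∘ H-loopless e ∘ φ-inj I , id ]′ (firstEdge (walk (ψ I e)))
  imageEdgeAt {e} (inj₂ refl) = [ ⊥-elim ∘ H-loopless e ∘ φ-inj I , id ]′ (lastEdge (walk (ψ I e)))

  branchVertex-notAtMostTwo : ∀ {x} → ThreeIncidentEdges H x → ¬ AtMostTwoIncidentEdges B (φ I x)
  branchVertex-notAtMostTwo t atMostTwo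
    with imageEdgeAt (x∈e₁ t) | imageEdgeAt (x∈e₂ t) | imageEdgeAt (x∈e₃ t)
  ... | g₁ , g₁∈ , x∈g₁ | g₂ , g₂∈ , x∈g₂ | g₃ , g₃∈ , x∈g₃ with atMostTwo x∈g₁ x∈g₂ x∈g₃
  ... | inj₁ refl        = ψ-disj I _ _ (e₁≢e₂ t) g₁ g₁∈ g₂∈
  ... | inj₂ (inj₁ refl) = ψ-disj I _ _ (e₁≢e₃ t) g₁ g₁∈ g₃∈
  ... | inj₂ (inj₂ refl) = ψ-disj I _ _ (e₂≢e₃ t) g₂ g₂∈ g₃∈

-- A map of A into B sends each edge a of A to a walk whose edges all lie over
-- a. Since no edge of B lies over two edges of A, images of edge-disjoint
-- walks are edge-disjoint.
record WalkMap (A B : Graph) : Set₁ where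
  field
    vertex   : V A → V B
    LiesOver : E B → E A → Set
    LiesOver-functional : ∀ {b a a′} → LiesOver b a → LiesOver b a′ → a ≡ a′
    edgeWalk : ∀ a {x y} → Joins A a x y →
      Σ (Walk B (vertex x) (vertex y)) λ w → ∀ {b} → b ∈ walkEdges w → LiesOver b a

module _ {A B : Graph} (M : WalkMap A B) where
  open WalkMap M

  LieOver : List (E B) → List (E A) → Set
  LieOver bs as = ∀ {b} → b ∈ bs → ∃ λ a → a ∈ as × LiesOver b a

  mapWalk : ∀ {x y} (w : Walk A x y) →
    Σ (Walk B (vertex x) (vertex y)) λ w′ → LieOver (walkEdges w′) (walkEdges w)
  mapWalk nil = nil , λ ()
  mapWalk (cons a j w) with edgeWalk a j | mapWalk w
  ... | w₁ , over₁ | w₂ , over₂ = w₁ ++ʷ w₂ , over ∘ ∈-++⁻ (walkEdges w₁) ∘ subst (_ ∈_) (walkEdges-++ʷ w₁ w₂)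
    where
    over : ∀ {b} → b ∈ walkEdges w₁ ⊎ b ∈ walkEdges w₂ → ∃ λ a′ → a′ ∈ walkEdges (cons a j w) × LiesOver b a′
    over (inj₁ b∈) = a , here refl , over₁ b∈
    over (inj₂ b∈) = let a′ , a′∈ , b/a′ = over₂ b∈ in a′ , there a′∈ , b/a′

  LieOver-disjoint : ∀ {bs bs′ as as′} → LieOver bs as → LieOver bs′ as′ →
    DisjointL as as′ → DisjointL bs bs′
  LieOver-disjoint over over′ disjoint b b∈ b∈′
    with over b∈ | over′ b∈′
  ... | a , a∈ , b/a | a′ , a′∈ , b/a′ with LiesOver-functional b/a b/a′
  ... | refl = disjoint a a∈ a′∈

  module _ (_≟_ : DecidableEquality (V B)) {H : Graph} where

    mapPath : ∀ {x y} (p : Path A x y) →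
      Σ (Path B (vertex x) (vertex y)) λ p′ → LieOver (pathEdges p′) (pathEdges p)
    mapPath p =
      let w , over = mapWalk (walk p) ; p′ , p′⊆w = shortcut _≟_ w
      in p′ , over ∘ p′⊆w

    mapImmersion : (I : Immersion H A) → Injective _≡_ _≡_ (vertex ∘ φ I) → Immersion H B
    mapImmersion I injective = record
      { φ = vertex ∘ φ I
      ; φ-inj = injective
      ; ψ = λ e → proj₁ (mapPath (ψ I e))
      ; ψ-disj = λ e e′ e≢e′ →
          LieOver-disjoint (proj₂ (mapPath (ψ I e))) (proj₂ (mapPath (ψ I e′))) (ψ-disj I e e′ e≢e′)
      }

    mapPacking : ∀ {k} (P : Packing H A k) →
      (∀ i → Injective _≡_ _≡_ (vertex ∘ φ (proj₁ P i))) → Packing H B k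
    mapPacking (I , disjoint) injective =
      (λ i → mapImmersion (I i) (injective i)) ,
      λ i j i≢j e e′ →
        LieOver-disjoint (proj₂ (mapPath (ψ (I i) e))) (proj₂ (mapPath (ψ (I j) e′)))
          (disjoint i j i≢j e e′)

embed-∖[] : (G : Graph) → WalkMap G (G ∖ [])
embed-∖[] G = record
  { vertex = id
  ; LiesOver = λ b a → proj₁ b ≡ a
  ; LiesOver-functional = λ { refl refl → refl }
  ; edgeWalk = λ a j → cons (a , λ ()) j nil , λ { (here refl) → refl }
  }

include-∖ : (G : Graph) (C : List (E G)) → WalkMap (G ∖ C) G
include-∖ G C = record
  { vertex = id
  ; LiesOver = λ b a → b ≡ proj₁ a
  ; LiesOver-functional = λ p q → Σ¬-≡ (trans (sym p) q)
  ; edgeWalk = λ a j → cons (proj₁ a) j nil , λ { (here refl) → refl }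
  }

IsPack-transfer : ∀ {H A B k} →
  (∀ {k} → Packing H A k → Packing H B k) → (∀ {k} → Packing H B k → Packing H A k) →
  IsPack H A k → IsPack H B k
IsPack-transfer A→B B→A (P , maximal) = A→B P , λ k′ P′ → maximal k′ (B→A P′)

CoverTransfer : Graph → Graph → Graph → Set
CoverTransfer H A B =
  ∀ C → IsCoverSet H A C → ∃ λ C′ → IsCoverSet H B C′ × length C′ ≤ length C

IsCover-transfer : ∀ {H A B c} → CoverTransfer H A B → CoverTransfer H B A →
  IsCover H A c → IsCover H B c
IsCover-transfer A→B B→A ((C , cover , refl) , minimal) =
  let C′ , cover′ , C′≤C = A→B C cover
  in (C′ , cover′ , ≤-antisym C′≤C (minimal-in-B C′ cover′)) , minimal-in-B
  where
  minimal-in-B : ∀ D → IsCoverSet _ _ D → length C ≤ length D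
  minimal-in-B D coverD = let D′ , coverD′ , D′≤D = B→A D coverD in ≤-trans (minimal D′ coverD′) D′≤D

module Subdivision {K : Graph} (s : E K → ℕ) where

  S : Graph
  S = subdivide K s

  -- The point function local to subdivide is not exported; ends-segment
  -- relates this copy to it.
  point : (e : E K) → ℕ → V S
  point e zero = inj₁ (proj₁ (ends K e))
  point e (suc k) with k <? s e
  ... | yes k<s = inj₂ (e , fromℕ< k<s)
  ... | no _ = inj₁ (proj₂ (ends K e))

  ends-segment : ∀ e (j : Fin (suc (s e))) →
    ends S (e , j) ≡ (point e (toℕ j) , point e (suc (toℕ j)))
  ends-segment e Fin.zero with 0 <? s e
  ... | yes _ = refl
  ... | no _ = refl
  ends-segment e (Fin.suc j) with toℕ j <? s e | suc (toℕ j) <? s e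
  ... | yes _ | yes _ = refl
  ... | yes _ | no _ = refl
  ... | no _ | yes _ = refl
  ... | no _ | no _ = refl

  point-last : ∀ e → point e (suc (s e)) ≡ inj₁ (proj₂ (ends K e))
  point-last e with s e <? s e
  ... | yes s<s = ⊥-elim (n≮n _ s<s)
  ... | no _ = refl

  point≡internal : ∀ {e′ e i} k → point e′ k ≡ inj₂ (e , i) → e′ ≡ e × k ≡ suc (toℕ i)
  point≡internal {e′} (suc k) p with k <? s e′
  point≡internal (suc k) refl | yes k<s = refl , cong suc (sym (toℕ-fromℕ< k<s))

  internal-incident : ∀ {a e i} → IsEndOf S a (inj₂ (e , i)) →
    a ≡ (e , inject₁ i) ⊎ a ≡ (e , Fin.suc i)
  internal-incident {e′ , j} (inj₁ p)
    with point≡internal (toℕ j) (sym (trans p (cong proj₁ (ends-segment e′ j))))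
  ... | refl , j≡1+i = inj₂ (cong (e′ ,_) (toℕ-injective j≡1+i))
  internal-incident {e′ , j} {i = i} (inj₂ p)
    with point≡internal (suc (toℕ j)) (sym (trans p (cong proj₂ (ends-segment e′ j))))
  ... | refl , 1+j≡1+i = inj₁ (cong (e′ ,_) (toℕ-injective (trans (suc-injective 1+j≡1+i) (sym (toℕ-inject₁ i)))))

  internal-atMostTwo : ∀ {e i} → AtMostTwoIncidentEdges S (inj₂ (e , i))
  internal-atMostTwo x∈g₁ x∈g₂ x∈g₃ =
    pigeonhole-two (internal-incident x∈g₁) (internal-incident x∈g₂) (internal-incident x∈g₃)

  collapse : V S → V K
  collapse (inj₁ v) = v
  collapse (inj₂ (e , _)) = proj₁ (ends K e)

  collapse-point : ∀ e k → k ≤ s e → collapse (point e k) ≡ proj₁ (ends K e)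
  collapse-point e zero _ = refl
  collapse-point e (suc k) k<s with k <? s e
  ... | yes _ = refl
  ... | no k≮s = ⊥-elim (k≮s k<s)

  lastSegment : E K → E S
  lastSegment e = e , fromℕ (s e)

  expand : (C : List (E K)) (C′ : List (E S)) → (∀ {g} → g ∈ C′ → proj₁ g ∈ C) →
    WalkMap (K ∖ C) (S ∖ C′)
  expand C C′ C′⊆C = record
    { vertex = inj₁
    ; LiesOver = λ b a → proj₁ (proj₁ b) ≡ proj₁ a
    ; LiesOver-functional = λ p q → Σ¬-≡ (trans (sym p) q)
    ; edgeWalk = λ { (e , e∉C) j →
        let w , along = alongEdge e e∉C (suc (s e)) ≤-refl
            w′ , w′⊆w = orient {A = K ∖ C} {a = e , e∉C} inj₁ j (castʷ refl (point-last e) w)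
        in w′ , along ∘ castʷ-⊆ _ _ w ∘ w′⊆w }
    }
    where
    alongEdge : ∀ e → e ∉ C → ∀ k → k ≤ suc (s e) →
      Σ (Walk (S ∖ C′) (point e 0) (point e k)) λ w → ∀ {b} → b ∈ walkEdges w → proj₁ (proj₁ b) ≡ e
    alongEdge e e∉C zero _ = nil , λ ()
    alongEdge e e∉C (suc k) k<1+s =
      let w , along = alongEdge e e∉C k (<⇒≤ k<1+s)
      in w ++ʷ step , [ along , (λ { (here refl) → refl }) ]′ ∘ ∈-++⁻ (walkEdges w) ∘ subst (_ ∈_) (walkEdges-++ʷ w step)
      where
      step : Walk (S ∖ C′) (point e k) (point e (suc k))
      step = cons ((e , fromℕ< k<1+s) , e∉C ∘ C′⊆C)
        (inj₁ (trans (ends-segment e _) (cong (λ t → point e t , point e (suc t)) (toℕ-fromℕ< k<1+s)))) nil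

  -- Only the last segment of e is mapped onto e; the other segments collapse
  -- to a single vertex.
  contract : (C : List (E K)) (C′ : List (E S)) → (∀ {f} → f ∈ C → lastSegment f ∈ C′) →
    WalkMap (S ∖ C′) (K ∖ C)
  contract C C′ C⊆C′ = record
    { vertex = collapse
    ; LiesOver = λ b a → proj₁ a ≡ lastSegment (proj₁ b)
    ; LiesOver-functional = λ p q → Σ¬-≡ (trans p (sym q))
    ; edgeWalk = λ { ((e , j) , e,j∉C′) J →
        let w , over = segmentImage e j e,j∉C′ (toℕ j <? s e)
            w′ , w′⊆w = orient {A = S ∖ C′} {a = (e , j) , e,j∉C′} collapse J
              (castʷ (cong (collapse ∘ proj₁) (sym (ends-segment e j)))
                     (cong (collapse ∘ proj₂) (sym (ends-segment e j))) w)
        in w′ , over ∘ castʷ-⊆ _ _ w ∘ w′⊆w }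
    }
    where
    segmentImage : ∀ e j → (e , j) ∉ C′ → Dec (toℕ j < s e) →
      Σ (Walk (K ∖ C) (collapse (point e (toℕ j))) (collapse (point e (suc (toℕ j))))) λ w →
        ∀ {b} → b ∈ walkEdges w → (e , j) ≡ lastSegment (proj₁ b)
    segmentImage e j _ (yes j<s)=
      castʷ (sym (collapse-point e (toℕ j) (toℕ≤pred[n] j))) (sym (collapse-point e (suc (toℕ j)) j<s)) nil ,
      (λ ()) ∘ castʷ-⊆ _ _ nil
    segmentImage e j e,j∉C′ (no j≮s)=
      castʷ start end edge , (λ { (here refl) → j≡last }) ∘ castʷ-⊆ start end edge
      where
      j≡s : toℕ j ≡ s e
      j≡s = ≤-antisym (toℕ≤pred[n] j) (≮⇒≥ j≮s)
      j≡last : (e , j) ≡ lastSegment e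
      j≡last = cong (e ,_) (toℕ-injective (trans j≡s (sym (toℕ-fromℕ (s e)))))
      edge : Walk (K ∖ C) (proj₁ (ends K e)) (proj₂ (ends K e))
      edge = cons (e , e,j∉C′ ∘ subst (_∈ C′) (sym j≡last) ∘ C⊆C′) (inj₁ refl) nil
      start : proj₁ (ends K e) ≡ collapse (point e (toℕ j))
      start = sym (collapse-point e (toℕ j) (toℕ≤pred[n] j))
      end : proj₂ (ends K e) ≡ collapse (point e (suc (toℕ j)))
      end = sym (trans (cong (collapse ∘ point e ∘ suc) j≡s) (cong collapse (point-last e)))

  module _ {H : Graph} (H-loopless : IsLoopless H) (H-degree : ∀ x → ThreeIncidentEdges H x) where

    branchVertex-notInternal : ∀ {C′} (I : Immersion H (S ∖ C′)) x {e i} → φ I x ≢ inj₂ (e , i)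
    branchVertex-notInternal I x φx≡ =
      branchVertex-notAtMostTwo H-loopless I (H-degree x)
        (subst (AtMostTwoIncidentEdges _) (sym φx≡) (∖-atMostTwo internal-atMostTwo))

    collapse-injective : ∀ {C′} (I : Immersion H (S ∖ C′)) → Injective _≡_ _≡_ (collapse ∘ φ I)
    collapse-injective I {x} {y} eq with φ I x in φx | φ I y in φy
    ... | inj₁ _ | inj₁ _ = φ-inj I (trans φx (trans (cong inj₁ eq) (sym φy)))
    ... | inj₂ _ | _      = ⊥-elim (branchVertex-notInternal I x φx)
    ... | inj₁ _ | inj₂ _ = ⊥-elim (branchVertex-notInternal I y φy)

    module _ (_≟V_ : DecidableEquality (V K)) (_≟E_ : DecidableEquality (E K)) where

      _≟S_ : DecidableEquality (V S)
      _≟S_ = Sum.≡-dec _≟V_ (Product.≡-dec _≟E_ _≟F_)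

      packing-to-subdivision : ∀ {k} → Packing H K k → Packing H S k
      packing-to-subdivision P₀ =
        let P₁ = mapPacking (embed-∖[] K) _≟V_ P₀ (λ i → φ-inj (proj₁ P₀ i))
            P₂ = mapPacking (expand [] [] λ ()) _≟S_ P₁ (λ i p → φ-inj (proj₁ P₁ i) (Sum.inj₁-injective p))
        in mapPacking (include-∖ S []) _≟S_ P₂ (λ i → φ-inj (proj₁ P₂ i))

      packing-from-subdivision : ∀ {k} → Packing H S k → Packing H K k
      packing-from-subdivision P₀ =
        let P₁ = mapPacking (embed-∖[] S) _≟S_ P₀ (λ i → φ-inj (proj₁ P₀ i))
            P₂ = mapPacking (contract [] [] λ ()) _≟V_ P₁ (λ i → collapse-injective (proj₁ P₁ i))
        in mapPacking (include-∖ K []) _≟V_ P₂ (λ i → φ-inj (proj₁ P₂ i))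

      cover-to-subdivision : CoverTransfer H K S
      cover-to-subdivision C (unique , noImmersion) =
        map lastSegment C ,
        ( Unique.map⁺ (cong proj₁) unique
        , λ J → noImmersion (mapImmersion (contract C _ (∈-map⁺ lastSegment)) _≟V_ J (collapse-injective J))) ,
        ≤-reflexive (length-map lastSegment C)

      cover-from-subdivision : CoverTransfer H S K
      cover-from-subdivision C′ (unique , noImmersion) =
        D ,
        ( UniqueDec.deduplicate-! _≟E_ _
        , λ J → noImmersion (mapImmersion (expand D C′ (∈-deduplicate⁺ _≟E_ ∘ ∈-map⁺ proj₁)) _≟S_ J
                               (λ p → φ-inj J (Sum.inj₁-injective p)))) ,
        ≤-trans (length-deduplicate _≟E_ (map proj₁ C′)) (≤-reflexive (length-map proj₁ C′))
        where
        D : List (E K)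
        D = deduplicate _≟E_ (map proj₁ C′)

      pack-invariant : ∀ k → IsPack H K k ⇔ IsPack H S k
      pack-invariant k = mk⇔
        (IsPack-transfer packing-to-subdivision packing-from-subdivision)
        (IsPack-transfer packing-from-subdivision packing-to-subdivision)

      cover-invariant : ∀ c → IsCover H K c ⇔ IsCover H S c
      cover-invariant c = mk⇔
        (IsCover-transfer cover-to-subdivision cover-from-subdivision)
        (IsCover-transfer cover-from-subdivision cover-to-subdivision)

attach-loopless : ∀ {K f} → IsLoopless K → IsLoopless (attach K f)
attach-loopless K-loopless (inj₁ e) = K-loopless e ∘ Sum.inj₁-injective
attach-loopless _ (inj₂ (_ , Fin.zero)) ()
attach-loopless _ (inj₂ (_ , Fin.suc Fin.zero)) ()
attach-loopless _ (inj₂ (_ , Fin.suc (Fin.suc _))) ()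

attach-≟V : ∀ {K f} → DecidableEquality (V K) → DecidableEquality (V (attach K f))
attach-≟V _≟_ = Sum.≡-dec _≟_ (Product.≡-dec (Product.≡-dec _≟_ _≟F_) _≟B_)

attach-≟E : ∀ {K f} → DecidableEquality (V K) → DecidableEquality (E K) → DecidableEquality (E (attach K f))
attach-≟E _≟V_ _≟E_ = Sum.≡-dec _≟E_ (Product.≡-dec (Product.≡-dec _≟V_ _≟F_) _≟F_)

⁺-threeIncidentEdges : ∀ {H} → (∀ v → ∃ λ e → IsEndOf H e v) → ∀ x → ThreeIncidentEdges (H ⁺) x
⁺-threeIncidentEdges noIsolated (inj₁ v) = record
  { e₁ = inj₂ ((v , Fin.zero) , Fin.zero)
  ; e₂ = inj₂ ((v , Fin.zero) , Fin.suc Fin.zero)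
  ; e₃ = inj₁ (proj₁ (noIsolated v))
  ; e₁≢e₂ = λ () ; e₁≢e₃ = λ () ; e₂≢e₃ = λ ()
  ; x∈e₁ = inj₁ refl
  ; x∈e₂ = inj₁ refl
  ; x∈e₃ = map⊎ (cong inj₁) (cong inj₁) (proj₂ (noIsolated v))
  }
⁺-threeIncidentEdges _ (inj₂ (vi , false)) = record
  { e₁ = inj₂ (vi , Fin.zero)
  ; e₂ = inj₂ (vi , Fin.suc (Fin.suc Fin.zero))
  ; e₃ = inj₂ (vi , Fin.suc (Fin.suc (Fin.suc Fin.zero)))
  ; e₁≢e₂ = λ () ; e₁≢e₃ = λ () ; e₂≢e₃ = λ ()
  ; x∈e₁ = inj₂ refl
  ; x∈e₂ = inj₁ refl
  ; x∈e₃ = inj₁ refl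
  }
⁺-threeIncidentEdges _ (inj₂ (vi , true)) = record
  { e₁ = inj₂ (vi , Fin.suc Fin.zero)
  ; e₂ = inj₂ (vi , Fin.suc (Fin.suc Fin.zero))
  ; e₃ = inj₂ (vi , Fin.suc (Fin.suc (Fin.suc Fin.zero)))
  ; e₁≢e₂ = λ () ; e₁≢e₃ = λ () ; e₂≢e₃ = λ ()
  ; x∈e₁ = inj₂ refl
  ; x∈e₂ = inj₂ refl
  ; x∈e₃ = inj₂ refl
  }

lemma5 : (G H : FinGraph) → Loopless G → Loopless H
    → Connected (toGraph H) → Fin (m H)
    → (s : E (G *) → ℕ)
    → ((k : ℕ) → IsPack (toGraph H ⁺) (G *) k ⇔ IsPack (toGraph H ⁺) (subdivide (G *) s) k)
    × ((c : ℕ) → IsCover (toGraph H ⁺) (G *) c ⇔ IsCover (toGraph H ⁺) (subdivide (G *) s) c)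
lemma5 G H _ H-loopless H-connected e₀ s =
  pack-invariant loopless degree ≟V ≟E , cover-invariant loopless degree ≟V ≟E
  where
  open Subdivision s
  loopless : IsLoopless (toGraph H ⁺)
  loopless = attach-loopless H-loopless
  degree : ∀ x → ThreeIncidentEdges (toGraph H ⁺) x
  degree = ⁺-threeIncidentEdges (connected⇒noIsolatedVertex H-connected e₀)
  ≟V : DecidableEquality (V (G *))
  ≟V = attach-≟V {toGraph G} {mdeg G} _≟F_
  ≟E : DecidableEquality (E (G *))
  ≟E = attach-≟E {toGraph G} {mdeg G} _≟F_ _≟F_
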